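{- For every label $X$ (nonempty finite subset of $\omega$), every formula $\varphi$ and every variable $x$, the sequent $$X:\forall x((\varphi\to\forall x\,\varphi)\to\forall x\,\varphi)\Rightarrow X:\forall x\,\varphi$$ is derivable in $\mathbf{G}(\mathsf{FBInqBQ})$. Therefore the sequent $\Rightarrow X:\big(\forall x((\varphi\to\forall x\,\varphi)\to\forall x\,\varphi)\big)\to\forall x\,\varphi$ is derivable in $\mathbf{G}(\mathsf{FBInqBQ})$ for every label $X$.
   Context: Language: countably infinite set of variables, countably infinite set of predicate symbols with arities (no identity, constants, function symbols). Formulas: $\varphi ::= P(x_1,\dots,x_m)\mid \bot\mid \varphi\to\varphi\mid\varphi\wedge\varphi\mid \varphi\veebar\varphi\mid \forall x\varphi\mid \bar\exists x\varphi$ ($\veebar$ inquisitive disjunction, $\bar\exists$ inquisitive existential). $\varphi[z/x]$ is capture-avoiding substitution. Calculus $\mathbf{G}(\mathsf{FBInqBQ})$: a label is a nonempty finite subset of $\omega$; a labelled formula is $X:\varphi$ with $X$ a label; a sequent $\Gamma\Rightarrow\Delta$ is a pair of finite multisets of labelled formulas. $X,Y$ range over labels. Initial sequents: $(\mathtt{id})$ $X:P(\bar x),\Gamma\Rightarrow\Delta,Y:P(\bar x)$ whenever $X\supseteq Y$; $(\bot\Rightarrow)$ $X:\bot,\Gamma\Rightarrow\Delta$. Rules (premises / conclusion): $(\Rightarrow\mathtt{at})$: $\Gamma\Rightarrow\Delta,\{k\}:P(\bar x)$ for every $k\in X$ / $\Gamma\Rightarrow\Delta,X:P(\bar x)$.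 $(\Rightarrow\wedge)$: $\Gamma\Rightarrow\Delta,X:\varphi$ and $\Gamma\Rightarrow\Delta,X:\psi$ / $\Gamma\Rightarrow\Delta,X:\varphi\wedge\psi$. $(\wedge\Rightarrow)$: $X:\varphi,X:\psi,\Gamma\Rightarrow\Delta$ / $X:\varphi\wedge\psi,\Gamma\Rightarrow\Delta$. $(\Rightarrow\veebar)$: $\Gamma\Rightarrow\Delta,X:\varphi,X:\psi$ / $\Gamma\Rightarrow\Delta,X:\varphi\veebar\psi$. $(\veebar\Rightarrow)$: $X:\varphi,\Gamma\Rightarrow\Delta$ and $X:\psi,\Gamma\Rightarrow\Delta$ / $X:\varphi\veebar\psi,\Gamma\Rightarrow\Delta$. $(\Rightarrow\to)$: $Y:\varphi,\Gamma\Rightarrow\Delta,Y:\psi$ for every label $Y\subseteq X$ / $\Gamma\Rightarrow\Delta,X:\varphi\to\psi$. $(\to\Rightarrow)$, for a label $Y\subseteq X$: $X:\varphi\to\psi,\Gamma\Rightarrow\Delta,Y:\varphi$ and $Y:\psi,X:\varphi\to\psi,\Gamma\Rightarrow\Delta$ / $X:\varphi\to\psi,\Gamma\Rightarrow\Delta$. $(\Rightarrow\forall)$: $\Gamma\Rightarrow\Delta,X:\varphi[z/x]$ / $\Gamma\Rightarrow\Delta,X:\forall x\varphi$, with $z$ not occurring in the conclusion. $(\forall\Rightarrow)$: $X:\varphi[y/x],X:\forall x\varphi,\Gamma\Rightarrow\Delta$ / $X:\forall x\varphi,\Gamma\Rightarrow\Delta$ ($y$ arbitrary). $(\Rightarrow\bar\exists)$: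 $\Gamma\Rightarrow\Delta,X:\bar\exists x\varphi,X:\varphi[y/x]$ / $\Gamma\Rightarrow\Delta,X:\bar\exists x\varphi$ ($y$ arbitrary). $(\bar\exists\Rightarrow)$: $X:\varphi[z/x],\Gamma\Rightarrow\Delta$ / $X:\bar\exists x\varphi,\Gamma\Rightarrow\Delta$, with $z$ not occurring in the conclusion. A derivation is a finite tree of sequents built from initial sequents by these rules; a sequent is derivable if it is the root of a derivation. -}

module Defs where

open import Data.Nat using (ℕ; suc; _⊔_; _≟_; _≡ᵇ_)
open import Data.Bool using (if_then_else_)
open import Data.Vec using (Vec)
import Data.Vec as Vec
open import Data.List using (List; []; _∷_; _++_; map; foldr; filter; concatMap)
open import Data.List.NonEmpty using (List⁺; [_]; toList)
open import Data.List.Membership.Propositional using (_∈_; _∉_)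
open import Data.List.Relation.Unary.Any using (any?)
open import Data.List.Relation.Binary.Permutation.Propositional using (_↭_)
open import Data.Product using (_×_; _,_)
open import Relation.Nullary using (does; ¬_)
open import Relation.Nullary.Decidable using (⌊_⌋)
open import Relation.Binary.PropositionalEquality using (_≢_)

Var : Set
Var = ℕ

-- Formulas.  A predicate symbol is a pair (p , m) where m is its arity;
-- the atom  atom p m xs  is  P_(p,m)(x_1,...,x_m).
data Fm : Set where
  atom : (p m : ℕ) → Vec Var m → Fm
  ⊥'   : Fm
  _⇒_  : Fm → Fm → Fm
  _∧'_ : Fm → Fm → Fm
  _⩒_  : Fm → Fm → Fm      -- inquisitive disjunction
  ∀'   : Var → Fm → Fm
  ∃'   : Var → Fm → Fm      -- inquisitive existential

infixr 5 _⇒_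
infixr 6 _∧'_ _⩒_

fv : Fm → List Var
fv (atom p m xs) = Vec.toList xs
fv ⊥' = []
fv (φ ⇒ ψ) = fv φ ++ fv ψ
fv (φ ∧' ψ) = fv φ ++ fv ψ
fv (φ ⩒ ψ) = fv φ ++ fv ψ
fv (∀' w φ) = filter (λ v → ¬? (v ≟ w)) (fv φ)
  where open import Relation.Nullary.Decidable using (¬?)
fv (∃' w φ) = filter (λ v → ¬? (v ≟ w)) (fv φ)
  where open import Relation.Nullary.Decidable using (¬?)

vars : Fm → List Var
vars (atom p m xs) = Vec.toList xs
vars ⊥' = []
vars (φ ⇒ ψ) = vars φ ++ vars ψ
vars (φ ∧' ψ) = vars φ ++ vars ψ
vars (φ ⩒ ψ) = vars φ ++ vars ψ
vars (∀' w φ) = w ∷ vars φ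
vars (∃' w φ) = w ∷ vars φ

maxL : List ℕ → ℕ
maxL = foldr _⊔_ 0

_[_↦_] : (Var → Var) → Var → Var → (Var → Var)
(σ [ w ↦ w' ]) v = if v ≡ᵇ w then w' else σ v

-- capture-avoiding simultaneous renaming: a bound variable is renamed to a
-- fresh one exactly when it would capture a renamed free variable.
fresh : (Var → Var) → Var → Fm → Var
fresh σ w φ =
  let S = map σ (fv φ) in
  if does (any? (w ≟_) S) then suc (maxL S ⊔ w) else w

rename : (Var → Var) → Fm → Fm
rename σ (atom p m xs) = atom p m (Vec.map σ xs)
rename σ ⊥' = ⊥'
rename σ (φ ⇒ ψ) = rename σ φ ⇒ rename σ ψ
rename σ (φ ∧' ψ) = rename σ φ ∧' rename σ ψ
rename σ (φ ⩒ ψ) = rename σ φ ⩒ rename σ ψ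
rename σ (∀' w φ) = let w' = fresh σ w (∀' w φ) in ∀' w' (rename (σ [ w ↦ w' ]) φ)
rename σ (∃' w φ) = let w' = fresh σ w (∃' w φ) in ∃' w' (rename (σ [ w ↦ w' ]) φ)

_[_/_] : Fm → Var → Var → Fm
φ [ z / x ] = rename ((λ v → v) [ x ↦ z ]) φ

-- Labels: nonempty finite subsets of ω, represented by nonempty lists.
Label : Set
Label = List⁺ ℕ

_⊆L_ : Label → Label → Set
Y ⊆L X = ∀ {k} → k ∈ toList Y → k ∈ toList X

LFm : Set
LFm = Label × Fm

varsCtx : List LFm → List Var
varsCtx = concatMap (λ { (_ , φ) → vars φ })

-- Finite multisets are represented by lists, closed under permutation (rule perm).
infix 3 _⊢_
data _⊢_ : List LFm → List LFm → Set where
  perm : ∀ {Γ Γ' Δ Δ'} → Γ ↭ Γ' → Δ ↭ Δ' → Γ ⊢ Δ → Γ' ⊢ Δ'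
  id   : ∀ {Γ Δ X Y p m xs} → Y ⊆L X →
         ((X , atom p m xs) ∷ Γ) ⊢ ((Y , atom p m xs) ∷ Δ)
  ⊥⇒   : ∀ {Γ Δ X} → ((X , ⊥') ∷ Γ) ⊢ Δ
  ⇒at  : ∀ {Γ Δ X p m xs} →
         (∀ k → k ∈ toList X → Γ ⊢ (([ k ] , atom p m xs) ∷ Δ)) →
         Γ ⊢ ((X , atom p m xs) ∷ Δ)
  ⇒∧   : ∀ {Γ Δ X φ ψ} → Γ ⊢ ((X , φ) ∷ Δ) → Γ ⊢ ((X , ψ) ∷ Δ) →
         Γ ⊢ ((X , φ ∧' ψ) ∷ Δ)
  ∧⇒   : ∀ {Γ Δ X φ ψ} → ((X , φ) ∷ (X , ψ) ∷ Γ) ⊢ Δ →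
         ((X , φ ∧' ψ) ∷ Γ) ⊢ Δ
  ⇒⩒   : ∀ {Γ Δ X φ ψ} → Γ ⊢ ((X , φ) ∷ (X , ψ) ∷ Δ) →
         Γ ⊢ ((X , φ ⩒ ψ) ∷ Δ)
  ⩒⇒   : ∀ {Γ Δ X φ ψ} → ((X , φ) ∷ Γ) ⊢ Δ → ((X , ψ) ∷ Γ) ⊢ Δ →
         ((X , φ ⩒ ψ) ∷ Γ) ⊢ Δ
  ⇒→   : ∀ {Γ Δ X φ ψ} →
         (∀ Y → Y ⊆L X → ((Y , φ) ∷ Γ) ⊢ ((Y , ψ) ∷ Δ)) →
         Γ ⊢ ((X , φ ⇒ ψ) ∷ Δ)
  →⇒   : ∀ {Γ Δ X Y φ ψ} → Y ⊆L X →
         ((X , φ ⇒ ψ) ∷ Γ) ⊢ ((Y , φ) ∷ Δ) →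
         ((Y , ψ) ∷ (X , φ ⇒ ψ) ∷ Γ) ⊢ Δ →
         ((X , φ ⇒ ψ) ∷ Γ) ⊢ Δ
  ⇒∀   : ∀ {Γ Δ X x φ z} →
         z ∉ varsCtx Γ → z ∉ varsCtx ((X , ∀' x φ) ∷ Δ) →
         Γ ⊢ ((X , φ [ z / x ]) ∷ Δ) →
         Γ ⊢ ((X , ∀' x φ) ∷ Δ)
  ∀⇒   : ∀ {Γ Δ X x φ} y →
         ((X , φ [ y / x ]) ∷ (X , ∀' x φ) ∷ Γ) ⊢ Δ →
         ((X , ∀' x φ) ∷ Γ) ⊢ Δ
  ⇒∃   : ∀ {Γ Δ X x φ} y →
         Γ ⊢ ((X , ∃' x φ) ∷ (X , φ [ y / x ]) ∷ Δ) →
         Γ ⊢ ((X , ∃' x φ) ∷ Δ)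
  ∃⇒   : ∀ {Γ Δ X x φ z} →
         z ∉ varsCtx ((X , ∃' x φ) ∷ Γ) → z ∉ varsCtx Δ →
         ((X , φ [ z / x ]) ∷ Γ) ⊢ Δ →
         ((X , ∃' x φ) ∷ Γ) ⊢ Δ

{-# OPTIONS --safe #-}
-- This is Casari's formula, and the proof is induction along the proper-subset order on labels,
-- which is well-founded because labels are finite.  To reach Z : ∀x φ, instantiate the premise at
-- a fresh z and apply (→⇒) with Z itself: the right premise Z : ∀x φ ⇒ Z : φ[z/x] is an axiom,
-- and the left premise Z : φ[z/x] → ∀x φ asks, for every W ⊆ Z, for W : ∀x φ from W : φ[z/x].
-- If W = Z this is identity on the right-hand side Z : φ[z/x]; otherwise W ⊂ Z and the induction
-- hypothesis applies.
module Submission where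

open import Defs
open import Data.List using ([]; _∷_)
open import Data.Product using (_×_; _,_)

open import Data.Bool using (if_then_else_)
open import Data.List using (List; length; filter; map)
open import Data.List.NonEmpty using (toList)
open import Data.List.Properties using (map-id-local)
open import Data.List.Membership.Propositional using (_∈_; _∉_; find)
open import Data.List.Membership.Propositional.Properties using (∈-++⁺ˡ; ∈-++⁺ʳ; ∈-filter⁺; ∈-filter⁻)
open import Data.List.Relation.Binary.Subset.Propositional using (_⊆_)
open import Data.List.Relation.Binary.Subset.Propositional.Properties using (⊆-refl; ⊆-trans)
import Data.List.Relation.Binary.Permutation.Propositional as ↭
open import Data.List.Relation.Unary.All as All using (all?)
open import Data.List.Relation.Unary.All.Properties using (¬All⇒Any¬)
open import Data.List.Relation.Unary.Any using (Any; here; there; any?)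
open import Data.Nat using (ℕ; suc; _+_; _≤_; _<_; _⊔_; z≤n; s≤s)
open import Data.Nat.Induction using (<-wellFounded)
open import Data.Nat.Properties using (_≟_; m≤m+n; m≤n+m; m≤n⇒m≤1+n; ≤-reflexive; ≤-trans; m≤m⊔n; m≤n⊔m; 1+n≰n)
open import Data.Product using (proj₁; proj₂)
open import Data.Sum using (_⊎_; inj₁; inj₂)
import Data.Vec as Vec
open import Function using (_∘_; _on_)
open import Induction.WellFounded using (WellFounded; Acc; acc)
open import Relation.Binary using (Rel; DecidableEquality)
import Relation.Binary.Construct.On as On
open import Relation.Binary.PropositionalEquality using (_≡_; _≢_; refl; sym; trans; cong; cong₂; subst)
open import Relation.Nullary using (¬_; yes; no; contradiction)
open import Relation.Nullary.Decidable using (dec-true; dec-false; ¬?)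
open import Relation.Unary using (Pred; Decidable)

update-≢ : ∀ σ {w w' v} → v ≢ w → (σ [ w ↦ w' ]) v ≡ σ v
update-≢ σ {w} {w'} {v} v≢w = cong (λ b → if b then w' else σ v) (dec-false (v ≟ w) v≢w)

update-self : ∀ σ w v → (v ≢ w → σ v ≡ v) → (σ [ w ↦ w ]) v ≡ v
update-self σ w v fix with v ≟ w
... | yes refl = cong (λ b → if b then w else σ w) (dec-true (w ≟ w) refl)
... | no v≢w   = trans (update-≢ σ v≢w) (fix v≢w)

fresh-id : ∀ σ w φ → (∀ {v} → v ∈ fv φ → σ v ≡ v) → w ∉ fv φ → fresh σ w φ ≡ w
fresh-id σ w φ fix w∉fv =
  cong (λ b → if b then suc (maxL (map σ (fv φ)) ⊔ w) else w)
       (dec-false (any? (w ≟_) (map σ (fv φ))) (subst (w ∉_) (sym σ-fixes-fv) w∉fv))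
  where
  σ-fixes-fv : map σ (fv φ) ≡ fv φ
  σ-fixes-fv = map-id-local (All.tabulate fix)

bound-∉-fv : ∀ w φ → w ∉ fv (∀' w φ)
bound-∉-fv w φ w∈fv = proj₂ (∈-filter⁻ (λ v → ¬? (v ≟ w)) {xs = fv φ} w∈fv) refl

update-self-fixes-fv : ∀ σ w φ → (∀ {v} → v ∈ fv (∀' w φ) → σ v ≡ v) →
                   ∀ {v} → v ∈ fv φ → (σ [ w ↦ w ]) v ≡ v
update-self-fixes-fv σ w φ fix {v} v∈fv = update-self σ w v (fix ∘ ∈-filter⁺ (λ v → ¬? (v ≟ w)) v∈fv)

Vec-map-id-local : ∀ {σ m} (xs : Vec.Vec Var m) → (∀ {v} → v ∈ Vec.toList xs → σ v ≡ v) → Vec.map σ xs ≡ xs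
Vec-map-id-local Vec.[]       fix = refl
Vec-map-id-local (x Vec.∷ xs) fix = cong₂ Vec._∷_ (fix (here refl)) (Vec-map-id-local xs (fix ∘ there))

rename-id-local : ∀ φ {σ} → (∀ {v} → v ∈ fv φ → σ v ≡ v) → rename σ φ ≡ φ
rename-id-local (atom p m xs) fix = cong (atom p m) (Vec-map-id-local xs fix)
rename-id-local ⊥'            fix = refl
rename-id-local (φ ⇒ ψ)       fix = cong₂ _⇒_ (rename-id-local φ (fix ∘ ∈-++⁺ˡ)) (rename-id-local ψ (fix ∘ ∈-++⁺ʳ (fv φ)))
rename-id-local (φ ∧' ψ)      fix = cong₂ _∧'_ (rename-id-local φ (fix ∘ ∈-++⁺ˡ)) (rename-id-local ψ (fix ∘ ∈-++⁺ʳ (fv φ)))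
rename-id-local (φ ⩒ ψ)       fix = cong₂ _⩒_ (rename-id-local φ (fix ∘ ∈-++⁺ˡ)) (rename-id-local ψ (fix ∘ ∈-++⁺ʳ (fv φ)))
rename-id-local (∀' w φ) {σ}  fix rewrite fresh-id σ w (∀' w φ) fix (bound-∉-fv w φ) =
  cong (∀' w) (rename-id-local φ (update-self-fixes-fv σ w φ fix))
-- fv (∃' w φ) is by definition the list fv (∀' w φ), so the binder lemmas stated for ∀' apply.
rename-id-local (∃' w φ) {σ}  fix rewrite fresh-id σ w (∃' w φ) fix (bound-∉-fv w φ) =
  cong (∃' w) (rename-id-local φ (update-self-fixes-fv σ w φ fix))

subst-∀-bound : ∀ x z φ → (∀' x φ) [ z / x ] ≡ ∀' x φ
subst-∀-bound x z φ =
  rename-id-local (∀' x φ) (λ v∈fv → update-≢ (λ v → v) (proj₂ (∈-filter⁻ (λ v → ¬? (v ≟ x)) {xs = fv φ} v∈fv)))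

size : Fm → ℕ
size (atom p m xs) = 1
size ⊥'            = 1
size (φ ⇒ ψ)       = suc (size φ + size ψ)
size (φ ∧' ψ)      = suc (size φ + size ψ)
size (φ ⩒ ψ)       = suc (size φ + size ψ)
size (∀' w φ)      = suc (size φ)
size (∃' w φ)      = suc (size φ)

size-rename : ∀ φ σ → size (rename σ φ) ≡ size φ
size-rename (atom p m xs) σ = refl
size-rename ⊥'            σ = refl
size-rename (φ ⇒ ψ)       σ = cong₂ (λ a b → suc (a + b)) (size-rename φ σ) (size-rename ψ σ)
size-rename (φ ∧' ψ)      σ = cong₂ (λ a b → suc (a + b)) (size-rename φ σ) (size-rename ψ σ)
size-rename (φ ⩒ ψ)       σ = cong₂ (λ a b → suc (a + b)) (size-rename φ σ) (size-rename ψ σ)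
size-rename (∀' w φ)      σ = cong suc (size-rename φ _)
size-rename (∃' w φ)      σ = cong suc (size-rename φ _)

⊢-swapˡ : ∀ {Γ Δ a b} → (a ∷ b ∷ Γ) ⊢ Δ → (b ∷ a ∷ Γ) ⊢ Δ
⊢-swapˡ = perm (↭.swap _ _ ↭.refl) ↭.refl

⊢-swapʳ : ∀ {Γ Δ a b} → Γ ⊢ (a ∷ b ∷ Δ) → Γ ⊢ (b ∷ a ∷ Δ)
⊢-swapʳ = perm ↭.refl (↭.swap _ _ ↭.refl)

⊢-rotateˡ : ∀ {Γ Δ a b c} → (c ∷ a ∷ b ∷ Γ) ⊢ Δ → (a ∷ b ∷ c ∷ Γ) ⊢ Δ
⊢-rotateˡ = perm (↭.trans (↭.swap _ _ ↭.refl) (↭.prep _ (↭.swap _ _ ↭.refl))) ↭.refl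

∀⇒≡ : ∀ {Γ Δ X x φ ψ} y → φ [ y / x ] ≡ ψ →
      ((X , ψ) ∷ (X , ∀' x φ) ∷ Γ) ⊢ Δ → ((X , ∀' x φ) ∷ Γ) ⊢ Δ
∀⇒≡ y refl = ∀⇒ y

∈⇒≤maxL : ∀ {v vs} → v ∈ vs → v ≤ maxL vs
∈⇒≤maxL {vs = v ∷ vs} (here refl) = m≤m⊔n v (maxL vs)
∈⇒≤maxL {vs = u ∷ vs} (there v∈vs) = ≤-trans (∈⇒≤maxL v∈vs) (m≤n⊔m u (maxL vs))

freshVar : List LFm → List LFm → Var
freshVar Γ Δ = suc (maxL (varsCtx Γ) ⊔ maxL (varsCtx Δ))

freshVar-∉ˡ : ∀ Γ Δ → freshVar Γ Δ ∉ varsCtx Γ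
freshVar-∉ˡ Γ Δ z∈Γ = 1+n≰n (≤-trans (∈⇒≤maxL z∈Γ) (m≤m⊔n _ _))

freshVar-∉ʳ : ∀ Γ Δ → freshVar Γ Δ ∉ varsCtx Δ
freshVar-∉ʳ Γ Δ z∈Δ = 1+n≰n (≤-trans (∈⇒≤maxL z∈Δ) (m≤n⊔m _ _))

⇒∀-fresh : ∀ {Γ Δ X x φ} → (∀ y → Γ ⊢ ((X , φ [ y / x ]) ∷ Δ)) → Γ ⊢ ((X , ∀' x φ) ∷ Δ)
⇒∀-fresh {Γ} {Δ} {X} {x} {φ} d = ⇒∀ (freshVar-∉ˡ Γ Δ') (freshVar-∉ʳ Γ Δ') (d _)
  where Δ' = (X , ∀' x φ) ∷ Δ

∃⇒-fresh : ∀ {Γ Δ X x φ} → (∀ y → ((X , φ [ y / x ]) ∷ Γ) ⊢ Δ) → ((X , ∃' x φ) ∷ Γ) ⊢ Δ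
∃⇒-fresh {Γ} {Δ} {X} {x} {φ} d = ∃⇒ (freshVar-∉ˡ Γ' Δ) (freshVar-∉ʳ Γ' Δ) (d _)
  where Γ' = (X , ∃' x φ) ∷ Γ

identity-acc : ∀ φ → Acc (_<_ on size) φ → ∀ {Γ Δ X Y} → Y ⊆L X → ((X , φ) ∷ Γ) ⊢ ((Y , φ) ∷ Δ)
identity-acc (atom p m xs) _ Y⊆X = id Y⊆X
identity-acc ⊥'            _ Y⊆X = ⊥⇒
identity-acc (φ ⇒ ψ) (acc rs) Y⊆X = ⇒→ λ Z Z⊆Y →
  ⊢-swapˡ (→⇒ (Y⊆X ∘ Z⊆Y)
    (⊢-swapˡ (identity-acc φ (rs (s≤s (m≤m+n _ _))) ⊆-refl))
    (identity-acc ψ (rs (s≤s (m≤n+m _ _))) ⊆-refl))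
identity-acc (φ ∧' ψ) (acc rs) Y⊆X =
  ∧⇒ (⇒∧ (identity-acc φ (rs (s≤s (m≤m+n _ _))) Y⊆X)
         (⊢-swapˡ (identity-acc ψ (rs (s≤s (m≤n+m _ _))) Y⊆X)))
identity-acc (φ ⩒ ψ) (acc rs) Y⊆X =
  ⩒⇒ (⇒⩒ (identity-acc φ (rs (s≤s (m≤m+n _ _))) Y⊆X))
     (⇒⩒ (⊢-swapʳ (identity-acc ψ (rs (s≤s (m≤n+m _ _))) Y⊆X)))
identity-acc (∀' w φ) (acc rs) Y⊆X = ⇒∀-fresh λ y →
  ∀⇒ y (identity-acc (φ [ y / w ]) (rs (s≤s (≤-reflexive (size-rename φ _)))) Y⊆X)
identity-acc (∃' w φ) (acc rs) Y⊆X = ∃⇒-fresh λ y →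
  ⇒∃ y (⊢-swapʳ (identity-acc (φ [ y / w ]) (rs (s≤s (≤-reflexive (size-rename φ _)))) Y⊆X))

identity : ∀ φ {Γ Δ X Y} → Y ⊆L X → ((X , φ) ∷ Γ) ⊢ ((Y , φ) ∷ Δ)
identity φ = identity-acc φ (On.wellFounded size <-wellFounded φ)

module _ {a p q} {A : Set a} {P : Pred A p} {Q : Pred A q}
         (P? : Decidable P) (Q? : Decidable Q) (P⇒Q : ∀ {x} → P x → Q x) where

  length-filter-mono : ∀ xs → length (filter P? xs) ≤ length (filter Q? xs)
  length-filter-mono []       = z≤n
  length-filter-mono (y ∷ xs) with P? y | Q? y
  ... | yes _  | yes _   = s≤s (length-filter-mono xs)
  ... | yes py | no ¬qy  = contradiction (P⇒Q py) ¬qy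
  ... | no _   | yes _   = m≤n⇒m≤1+n (length-filter-mono xs)
  ... | no _   | no _    = length-filter-mono xs

  length-filter-mono-< : ∀ {x xs} → x ∈ xs → Q x → ¬ P x → length (filter P? xs) < length (filter Q? xs)
  length-filter-mono-< {xs = y ∷ xs} (here refl) qy ¬py with P? y | Q? y
  ... | yes py | _       = contradiction py ¬py
  ... | no _   | yes _   = s≤s (length-filter-mono xs)
  ... | no _   | no ¬qy  = contradiction qy ¬qy
  length-filter-mono-< {xs = y ∷ xs} (there x∈xs) qx ¬px with P? y | Q? y
  ... | yes _  | yes _   = s≤s (length-filter-mono-< x∈xs qx ¬px)
  ... | yes py | no ¬qy  = contradiction (P⇒Q py) ¬qy
  ... | no _   | yes _   = m≤n⇒m≤1+n (length-filter-mono-< x∈xs qx ¬px)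
  ... | no _   | no _    = length-filter-mono-< x∈xs qx ¬px

infix 4 _⊂_
_⊂_ : ∀ {a} {A : Set a} → Rel (List A) a
ys ⊂ xs = ys ⊆ xs × Any (_∉ ys) xs

module _ {a} {A : Set a} (_≟ᴬ_ : DecidableEquality A) where
  open import Data.List.Membership.DecPropositional _≟ᴬ_ using (_∈?_)

  ⊆⇒⊇⊎⊂ : ∀ {xs ys : List A} → ys ⊆ xs → xs ⊆ ys ⊎ ys ⊂ xs
  ⊆⇒⊇⊎⊂ {xs} {ys} ys⊆xs with all? (_∈? ys) xs
  ... | yes xs⊆ys = inj₁ (All.lookup xs⊆ys)
  ... | no  xs⊈ys = inj₂ (ys⊆xs , ¬All⇒Any¬ (_∈? ys) xs xs⊈ys)

  ⊂-wellFounded : WellFounded (_⊂_ {A = A})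
  ⊂-wellFounded xs = acc-⊆ (On.wellFounded entriesIn <-wellFounded xs) ⊆-refl
    where
    -- A proper subset may be a longer list (entries can repeat), so the measure counts entries of xs.
    entriesIn : List A → ℕ
    entriesIn ys = length (filter (_∈? ys) xs)

    acc-⊆ : ∀ {ys} → Acc (_<_ on entriesIn) ys → ys ⊆ xs → Acc _⊂_ ys
    acc-⊆ {ys} (acc rs) ys⊆xs = acc λ {zs} zs⊂ys →
      let (k , k∈ys , k∉zs) = find (proj₂ zs⊂ys) in
      acc-⊆ (rs (length-filter-mono-< (_∈? zs) (_∈? ys) (proj₁ zs⊂ys) (ys⊆xs k∈ys) k∈ys k∉zs))
            (⊆-trans (proj₁ zs⊂ys) ys⊆xs)

module _ (φ : Fm) (x : Var) where
  private
    C : Fm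
    C = (φ ⇒ ∀' x φ) ⇒ ∀' x φ

    C-instance : ∀ z → C [ z / x ] ≡ (φ [ z / x ] ⇒ ∀' x φ) ⇒ ∀' x φ
    C-instance z = cong₂ _⇒_ (cong (φ [ z / x ] ⇒_) (subst-∀-bound x z φ)) (subst-∀-bound x z φ)

  Casari⊢ : Label → Label → Set
  Casari⊢ X Z = ∀ {Γ Δ} → ((X , ∀' x C) ∷ Γ) ⊢ ((Z , ∀' x φ) ∷ Δ)

  casari-step : ∀ {X} Z → Z ⊆L X → (∀ W → toList W ⊂ toList Z → Casari⊢ X W) → Casari⊢ X Z
  casari-step {X} Z Z⊆X below {Γ} {Δ} = ⇒∀-fresh λ z →
    ∀⇒≡ z (C-instance z) (→⇒ Z⊆X (⇒→ (φz⊢∀φ z)) (∀⇒ z (identity (φ [ z / x ]) ⊆-refl)))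
    where
    φz⊢∀φ : ∀ z W → W ⊆L Z →
            ((W , φ [ z / x ]) ∷ (X , (φ [ z / x ] ⇒ ∀' x φ) ⇒ ∀' x φ) ∷ (X , ∀' x C) ∷ Γ)
              ⊢ ((W , ∀' x φ) ∷ (Z , φ [ z / x ]) ∷ Δ)
    φz⊢∀φ z W W⊆Z with ⊆⇒⊇⊎⊂ _≟_ W⊆Z
    ... | inj₁ Z⊆W = ⊢-swapʳ (identity (φ [ z / x ]) Z⊆W)
    ... | inj₂ W⊂Z = ⊢-rotateˡ (below W W⊂Z)

  casari : ∀ {X} Z → Z ⊆L X → Casari⊢ X Z
  casari Z = casari-acc Z (⊂-wellFounded _≟_ (toList Z))
    where
    casari-acc : ∀ {X} Z → Acc _⊂_ (toList Z) → Z ⊆L X → Casari⊢ X Z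
    casari-acc Z (acc rs) Z⊆X = casari-step Z Z⊆X λ W W⊂Z → casari-acc W (rs W⊂Z) (Z⊆X ∘ proj₁ W⊂Z)

proposition6 : (X : Label) (φ : Fm) (x : Var) →
    (((X , ∀' x ((φ ⇒ ∀' x φ) ⇒ ∀' x φ)) ∷ []) ⊢ ((X , ∀' x φ) ∷ []))
    × ([] ⊢ ((X , (∀' x ((φ ⇒ ∀' x φ) ⇒ ∀' x φ)) ⇒ ∀' x φ) ∷ []))
proposition6 X φ x = casari φ x X ⊆-refl , ⇒→ λ Y _ → casari φ x Y ⊆-refl
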